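{- Let $2<k<n-2$, let $v_1,\dots,v_{\binom nk}$ be the vertices of $\Delta(k,n)$ in descending lexicographic order, and let $\kappa=\kappa_{k,n}$ be the lifting function with $\kappa(v_i)=1$ for $1\le i\le\binom{n-1}{k-1}-1$ and $\kappa(v_i)=0$ otherwise. Then the dual graph of the regular subdivision $\Delta(k,n)^\kappa$ is complete.
   Context: The hypersimplex $\Delta(k,n)=\operatorname{conv}\{e_X : X\subseteq[n],\ |X|=k\}\subset\mathbb{R}^n$ with $e_X=\sum_{i\in X}e_i$; vertices are ordered in descending lexicographic order as 0/1-vectors (e.g., for $\Delta(2,4)$: $1100,1010,1001,0110,0101,0011$). A lifting function $\omega$ induces the regular subdivision $\Delta(k,n)^\omega$, whose cells are the projections (omitting the last coordinate) of the lower faces of $\operatorname{conv}\{(v,\omega(v))\}$. The dual graph of a subdivision is the (multi)graph whose nodes are the maximal cells, with one edge between two nodes for each codimension-one face shared by the corresponding maximal cells. -}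

module Defs where

open import Data.Nat as ℕ using (ℕ; zero; suc; _∸_; _<ᵇ_)
open import Data.Nat.Combinatorics using (_C_)
open import Data.Bool using (Bool; true; false; if_then_else_)
open import Data.List using (List; []; _∷_; _++_; map; length)
open import Data.Vec as Vec using (Vec; []; _∷_; zipWith; replicate)
open import Data.Fin using (Fin; zero; suc; toℕ)
open import Data.Fin.Subset using (Subset; _∈_; _⊆_)
open import Data.Rational as ℚ using (ℚ; 0ℚ; 1ℚ; _+_; _*_; _≤_)
open import Data.Product using (Σ; ∃; ∃-syntax; _×_)
open import Function.Bundles using (_⇔_)
open import Relation.Binary.PropositionalEquality using (_≡_)
open import Relation.Nullary using (¬_)

-- Vertices of the hypersimplex Δ(k,n) as 0/1-vectors of length n with
-- exactly k ones, listed in DESCENDING lexicographic order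
-- (e.g. Δ(2,4): 1100,1010,1001,0110,0101,0011).

hyperVerts : (k n : ℕ) → List (Vec Bool n)
hyperVerts zero    zero    = [] ∷ []
hyperVerts (suc k) zero    = []
hyperVerts zero    (suc n) = map (false ∷_) (hyperVerts zero n)
hyperVerts (suc k) (suc n) =
  map (true ∷_) (hyperVerts k n) ++ map (false ∷_) (hyperVerts (suc k) n)

N : ℕ → ℕ → ℕ
N k n = length (hyperVerts k n)

b2q : Bool → ℚ
b2q true  = 1ℚ
b2q false = 0ℚ

-- the i-th vertex (0-indexed; the paper's v_{i+1}) as a point of ℚ^n
vert : (k n : ℕ) → Fin (N k n) → Vec ℚ n
vert k n i = Vec.map b2q (Data.List.lookup (hyperVerts k n) i)

dot : ∀ {n} → Vec ℚ n → Vec ℚ n → ℚ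
dot []       []       = 0ℚ
dot (x ∷ xs) (y ∷ ys) = x * y + dot xs ys

sumF : ∀ {m} → (Fin m → ℚ) → ℚ
sumF {zero}  f = 0ℚ
sumF {suc m} f = f zero + sumF (λ j → f (suc j))

sumV : ∀ {m n} → (Fin m → Vec ℚ n) → Vec ℚ n
sumV {zero}  {n} f = replicate n 0ℚ
sumV {suc m} {n} f = zipWith _+_ (f zero) (sumV (λ j → f (suc j)))

scale : ∀ {n} → ℚ → Vec ℚ n → Vec ℚ n
scale c = Vec.map (c *_)

AffIndep : ∀ {m n} → (Fin m → Vec ℚ n) → Set
AffIndep {m} {n} p =
  (λc : Fin m → ℚ) →
  sumF λc ≡ 0ℚ →
  sumV (λ j → scale (λc j) (p j)) ≡ replicate n 0ℚ →
  ∀ j → λc j ≡ 0ℚ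

HasDim : (k n : ℕ) → Subset (N k n) → ℕ → Set
HasDim k n S d =
  (Σ (Fin (suc d) → Fin (N k n)) λ ix → ((∀ j → ix j ∈ S) × AffIndep {suc d} (λ j → vert k n (ix j))))
  × (∀ (ix : Fin (suc (suc d)) → Fin (N k n)) → (∀ j → ix j ∈ S) →
       ¬ AffIndep (λ j → vert k n (ix j)))

-- A cell is (the convex hull of) the vertex set of a lower face of
-- conv{(v, ω v)}: a face cut out by a supporting hyperplane whose inner
-- normal has positive last coordinate, normalised to (a , 1).

IsCell : (k n : ℕ) → (Fin (N k n) → ℚ) → Subset (N k n) → Set
IsCell k n ω S =
  Σ (Vec ℚ n) λ a → Σ ℚ λ c →
    (∀ i → c ≤ dot a (vert k n i) + ω i) ×
    (∀ i → (dot a (vert k n i) + ω i ≡ c) ⇔ (i ∈ S))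

IsMaxCell : (k n : ℕ) → (Fin (N k n) → ℚ) → Subset (N k n) → Set
IsMaxCell k n ω S =
  IsCell k n ω S × (∀ T → IsCell k n ω T → S ⊆ T → T ≡ S)

IsFaceOf : (k n : ℕ) → Subset (N k n) → Subset (N k n) → Set
IsFaceOf k n F S =
  F ⊆ S ×
  (Σ (Vec ℚ n) λ b → Σ ℚ λ d →
    (∀ i → i ∈ S → d ≤ dot b (vert k n i)) ×
    (∀ i → i ∈ S → (dot b (vert k n i) ≡ d) ⇔ (i ∈ F)))

Adjacent : (k n : ℕ) → Subset (N k n) → Subset (N k n) → Set
Adjacent k n P Q =
  ∃[ F ] ∃[ d ]
    IsFaceOf k n F P × IsFaceOf k n F Q ×
    HasDim k n P (suc d) × HasDim k n Q (suc d) × HasDim k n F d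

DualGraphComplete : (k n : ℕ) → (Fin (N k n) → ℚ) → Set
DualGraphComplete k n ω =
  ∀ P Q → IsMaxCell k n ω P → IsMaxCell k n ω Q → ¬ (P ≡ Q) → Adjacent k n P Q

-- κ_{k,n}: κ(v_i) = 1 for 1 ≤ i ≤ C(n-1,k-1) - 1, else 0
-- (with 0-indexed position p = i - 1: value 1 iff p < C(n-1,k-1) - 1)

κ : (k n : ℕ) → Fin (N k n) → ℚ
κ k n i = if toℕ i <ᵇ (((n ∸ 1) C (k ∸ 1)) ∸ 1) then 1ℚ else 0ℚ

{-# OPTIONS --safe #-}
-- On the vertices of Δ(k,n) we have κ = x₀ − [v = a], where the apex a is the last vertex with x₀ = 1.
-- Since x₀ is linear, Δ(k,n)^κ is the pulling of Δ(k,n) at a: its maximal cells are the pyramids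
-- Cⱼ = conv({a} ∪ {x : xⱼ ≠ aⱼ}) over the facets of Δ(k,n) that miss a. Each Cⱼ is a lower face, cut out
-- by −x₀ ∓ xⱼ. Conversely, the vertices other than a of a lower face are the minimisers of a linear
-- functional on Δ(k,n) that a does not minimise; by an exchange argument, if every coordinate of a were
-- matched by some minimiser then a would be a minimiser as well, so some coordinate j separates the face
-- from a and the face lies in Cⱼ. Two cells Cⱼ and Cₗ share the face F = conv({a} ∪ {x : xⱼ ≠ aⱼ, xₗ ≠ aₗ}),
-- and for 2 < k < n − 2 explicit affinely independent families of vertices give dim Cⱼ = n − 1 and
-- dim F = n − 2, so any two maximal cells are adjacent.
module Submission where

open import Defs

-- ℚ's _+_ stays inside this module, so that the _+_ in the statement of lemma4p10 is ℕ's.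
module Hypersimplex where

  open import Data.Bool as Bool using (Bool; true; false; not; _∧_; _∨_; _xor_; if_then_else_)
  import Data.Bool.Properties as Bool
  open import Data.Empty using (⊥-elim)
  open import Data.Fin as Fin using (Fin; zero; suc; toℕ; punchIn; punchOut)
  open import Data.Fin.Properties using (any?; ¬∀⟶∃¬; punchIn-punchOut; toℕ-fromℕ<; toℕ-injective)
  open import Data.Fin.Subset using (Subset; ∣_∣; _∈_; _⊆_)
  open import Data.Fin.Subset.Properties using (_∈?_; ∣p∣≤n)
  open import Data.List as List using (List; []; _∷_; _++_; map; length)
  open import Data.List.Membership.Propositional using () renaming (_∈_ to _∈ₗ_)
  open import Data.List.Membership.Propositional.Properties
    using (∈-map⁺; ∈-map⁻; ∈-++⁺ˡ; ∈-++⁺ʳ; ∈-++⁻; ∈-lookup)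
  import Data.List.Properties as List
  open import Data.List.Relation.Unary.Any as Any using (here)
  open import Data.List.Relation.Unary.Any.Properties using (lookup-index)
  open import Data.Nat as ℕ using (ℕ; zero; suc; s≤s; z≤n; _∸_; _<ᵇ_)
  import Data.Nat.Properties as ℕ
  open import Data.Nat.Combinatorics using (nCk+nC[k+1]≡[n+1]C[k+1]) renaming (_C_ to _choose_)
  open import Data.Product as Product using (Σ; ∃-syntax; _×_; _,_; proj₁; proj₂)
  open import Data.Rational as ℚ using (ℚ; 0ℚ; 1ℚ; _+_; _*_; -_; _-_; 1/_; _≤_)
  open import Data.Rational.Properties
  open import Data.Rational.Solver using (module +-*-Solver)
  open import Data.Sum using (inj₁; inj₂)
  open import Data.Vec as Vec using (Vec; []; _∷_; lookup; tabulate; _[_]≔_)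
  import Data.Vec.Properties as Vec
  open import Data.Vec.Functional using (insertAt) renaming (_∷_ to _∷ᶠ_)
  open import Data.Vec.Functional.Properties using (insertAt-lookup; insertAt-punchIn)
  open import Function using (_∘_; id)
  open import Function.Bundles using (_⇔_; mk⇔; Equivalence)
  open import Relation.Binary.PropositionalEquality
  open import Relation.Nullary using (¬_; Dec; yes; no; does)
  open import Relation.Nullary.Decidable using (¬?; _×-dec_)

  open +-*-Solver

  +-cancelˡ-≤ : ∀ x {y z} → x + y ≤ x + z → y ≤ z
  +-cancelˡ-≤ x {y} {z} x+y≤x+z = begin
    y              ≡⟨ solve 2 (λ x y → y := :- x :+ (x :+ y)) refl x y ⟩
    - x + (x + y)  ≤⟨ +-monoʳ-≤ (- x) x+y≤x+z ⟩
    - x + (x + z)  ≡⟨ solve 2 (λ x z → :- x :+ (x :+ z) := z) refl x z ⟩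
    z              ∎
    where open ≤-Reasoning

  *-cancelʳ-≡0 : ∀ x y → x * y ≡ 0ℚ → y ≢ 0ℚ → x ≡ 0ℚ
  *-cancelʳ-≡0 x y xy≡0 y≢0 = begin
    x                ≡⟨ sym (*-identityʳ x) ⟩
    x * 1ℚ           ≡⟨ cong (x *_) (sym (*-inverseʳ y)) ⟩
    x * (y * 1/ y)   ≡⟨ sym (*-assoc x y _) ⟩
    (x * y) * 1/ y   ≡⟨ cong (_* 1/ y) xy≡0 ⟩
    0ℚ * 1/ y        ≡⟨ *-zeroˡ (1/ y) ⟩
    0ℚ               ∎
    where
    open ≡-Reasoning
    instance _ = ℚ.≢-nonZero y≢0

  +-cancelˡ-≡0 : ∀ {a s} → a ≡ 0ℚ → a + s ≡ 0ℚ → s ≡ 0ℚ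
  +-cancelˡ-≡0 {a} {s} a≡0 a+s≡0 = trans (sym (+-identityˡ s)) (trans (cong (_+ s) (sym a≡0)) a+s≡0)

  b2q-not≢ : ∀ b → - b2q b + b2q (not b) ≢ 0ℚ
  b2q-not≢ true  ()
  b2q-not≢ false ()

  c≤c+b2q : ∀ c b → c ≤ c + b2q b
  c≤c+b2q c b = subst (_≤ c + b2q b) (+-identityʳ c) (+-monoʳ-≤ c (0≤b2q b))
    where
    0≤b2q : ∀ b → 0ℚ ≤ b2q b
    0≤b2q true  = nonNegative⁻¹ 1ℚ
    0≤b2q false = ≤-refl

  c+b2q-not≡c⇔ : ∀ c b → (c + b2q (not b) ≡ c) ⇔ (b ≡ true)
  c+b2q-not≡c⇔ c b = mk⇔ (to b) (λ { refl → +-identityʳ c })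
    where
    to : ∀ b → c + b2q (not b) ≡ c → b ≡ true
    to true  _  = refl
    to false eq = ⊥-elim (1≢0 (trans (solve 2 (λ c x → x := :- c :+ (c :+ x)) refl c 1ℚ)
                                     (trans (cong (- c +_) eq) (+-inverseˡ c))))

  b2q-xor : ∀ b s → b2q s + (if s then - 1ℚ else 1ℚ) * b2q b ≡ b2q (b xor s)
  b2q-xor true  true  = refl
  b2q-xor true  false = refl
  b2q-xor false true  = refl
  b2q-xor false false = refl

  xor-≢ : ∀ {b s} → b ≢ s → b xor s ≡ true
  xor-≢ {true}  {true}  b≢s = ⊥-elim (b≢s refl)
  xor-≢ {true}  {false} _   = refl
  xor-≢ {false} {true}  _   = refl
  xor-≢ {false} {false} b≢s = ⊥-elim (b≢s refl)

  if-b2q : ∀ b → (if b then 1ℚ else 0ℚ) ≡ b2q b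
  if-b2q true  = refl
  if-b2q false = refl

  facetIndicator : ∀ e dⱼ dₗ → e ∨ dⱼ ≡ true → (e ≡ true → dⱼ ≡ false × dₗ ≡ false) →
                   b2q dⱼ - b2q dₗ ≡ b2q (not (e ∨ (dⱼ ∧ dₗ)))
  facetIndicator true  _     _     _ apex with apex refl
  ... | refl , refl = refl
  facetIndicator false true  true  _ _ = refl
  facetIndicator false true  false _ _ = refl

  sumF-cong : ∀ {m} {f g : Fin m → ℚ} → (∀ j → f j ≡ g j) → sumF f ≡ sumF g
  sumF-cong {zero}  _  = refl
  sumF-cong {suc m} eq = cong₂ _+_ (eq zero) (sumF-cong (eq ∘ suc))

  sumF-zero : ∀ m → sumF {m} (λ _ → 0ℚ) ≡ 0ℚ
  sumF-zero zero    = refl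
  sumF-zero (suc m) = trans (+-identityˡ _) (sumF-zero m)

  sumF-vanishing : ∀ {m} {f : Fin m → ℚ} → (∀ j → f j ≡ 0ℚ) → sumF f ≡ 0ℚ
  sumF-vanishing {m} eq = trans (sumF-cong eq) (sumF-zero m)

  sumF-+ : ∀ {m} (f g : Fin m → ℚ) → sumF (λ j → f j + g j) ≡ sumF f + sumF g
  sumF-+ {zero}  f g = refl
  sumF-+ {suc m} f g = trans (cong (f zero + g zero +_) (sumF-+ (f ∘ suc) (g ∘ suc)))
    (solve 4 (λ a b c d → (a :+ b) :+ (c :+ d) := (a :+ c) :+ (b :+ d)) refl
       (f zero) (g zero) (sumF (f ∘ suc)) (sumF (g ∘ suc)))

  sumF-*ˡ : ∀ {m} c (f : Fin m → ℚ) → sumF (λ j → c * f j) ≡ c * sumF f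
  sumF-*ˡ {zero}  c f = sym (*-zeroʳ c)
  sumF-*ˡ {suc m} c f = trans (cong (c * f zero +_) (sumF-*ˡ c (f ∘ suc))) (sym (*-distribˡ-+ c _ _))

  sumF-*ʳ : ∀ {m} c (f : Fin m → ℚ) → sumF (λ j → f j * c) ≡ sumF f * c
  sumF-*ʳ c f = trans (sumF-cong (λ j → *-comm (f j) c)) (trans (sumF-*ˡ c f) (*-comm c _))

  sumF-punchIn : ∀ {m} (f : Fin (suc m) → ℚ) r → sumF f ≡ f r + sumF (f ∘ punchIn r)
  sumF-punchIn f zero = refl
  sumF-punchIn {suc m} f (suc r) = trans (cong (f zero +_) (sumF-punchIn (f ∘ suc) r))
    (solve 3 (λ a b c → a :+ (b :+ c) := b :+ (a :+ c)) refl (f zero) (f (suc r)) _)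

  sumF-comm : ∀ {m p} (f : Fin m → Fin p → ℚ) →
              sumF (λ j → sumF (f j)) ≡ sumF (λ i → sumF (λ j → f j i))
  sumF-comm {zero}  {p} f = sym (sumF-zero p)
  sumF-comm {suc m} f = trans (cong (sumF (f zero) +_) (sumF-comm (f ∘ suc))) (sym (sumF-+ (f zero) _))

  δ : ∀ {n} → Fin n → Fin n → ℚ
  δ j i = b2q (does (j Fin.≟ i))

  sumF-δ : ∀ {n} (j : Fin n) (x : Fin n → ℚ) → sumF (λ i → δ j i * x i) ≡ x j
  sumF-δ {suc n} zero x = begin
    1ℚ * x zero + sumF (λ i → 0ℚ * x (suc i))
      ≡⟨ cong₂ _+_ (*-identityˡ (x zero)) (sumF-vanishing (λ i → *-zeroˡ (x (suc i)))) ⟩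
    x zero + 0ℚ
      ≡⟨ +-identityʳ _ ⟩
    x zero ∎
    where open ≡-Reasoning
  sumF-δ {suc n} (suc j) x = trans (cong (_+ sumF (λ i → δ j i * x (suc i))) (*-zeroˡ (x zero)))
                                   (trans (+-identityˡ _) (sumF-δ j (x ∘ suc)))

  pairCoeff : ∀ {n} → ℚ → Fin n → ℚ → Fin n → Fin n → ℚ
  pairCoeff β₁ j β₂ l i = β₁ * δ j i + β₂ * δ l i

  sumF-pairCoeff : ∀ {n} β₁ j β₂ l (x : Fin n → ℚ) →
                   sumF (λ i → pairCoeff β₁ j β₂ l i * x i) ≡ β₁ * x j + β₂ * x l
  sumF-pairCoeff β₁ j β₂ l x = begin
    sumF (λ i → (β₁ * δ j i + β₂ * δ l i) * x i)
      ≡⟨ sumF-cong (λ i → solve 5 (λ a d b e y → (a :* d :+ b :* e) :* y := a :* (d :* y) :+ b :* (e :* y))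
                                refl β₁ (δ j i) β₂ (δ l i) (x i)) ⟩
    sumF (λ i → β₁ * (δ j i * x i) + β₂ * (δ l i * x i))
      ≡⟨ sumF-+ (λ i → β₁ * (δ j i * x i)) (λ i → β₂ * (δ l i * x i)) ⟩
    sumF (λ i → β₁ * (δ j i * x i)) + sumF (λ i → β₂ * (δ l i * x i))
      ≡⟨ cong₂ _+_ (trans (sumF-*ˡ β₁ (λ i → δ j i * x i)) (cong (β₁ *_) (sumF-δ j x)))
                   (trans (sumF-*ˡ β₂ (λ i → δ l i * x i)) (cong (β₂ *_) (sumF-δ l x))) ⟩
    β₁ * x j + β₂ * x l ∎
    where open ≡-Reasoning

  -- Affine independence of the rows of a matrix

  Matrix : ℕ → ℕ → Set
  Matrix m N = Fin m → Fin N → ℚ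

  LinIndepRows : ∀ {m N} → Matrix m N → Set
  LinIndepRows {m} {N} p =
    (w : Fin m → ℚ) → (∀ i → sumF (λ j → w j * p j i) ≡ 0ℚ) → ∀ j → w j ≡ 0ℚ

  AffIndepRows : ∀ {m N} → Matrix m N → Set
  AffIndepRows {m} {N} p =
    (w : Fin m → ℚ) → sumF w ≡ 0ℚ → (∀ i → sumF (λ j → w j * p j i) ≡ 0ℚ) → ∀ j → w j ≡ 0ℚ

  module Elimination {m N} (p : Matrix (suc m) (suc N)) (r : Fin (suc m)) (pivot≢0 : p r zero ≢ 0ℚ) where

    private instance
      pivot-nonZero = ℚ.≢-nonZero pivot≢0

    factor : Fin m → ℚ
    factor s = p (punchIn r s) zero * 1/ p r zero

    reduced : Matrix m N
    reduced s i = p (punchIn r s) (suc i) - factor s * p r (suc i)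

    reduced-linIndep : LinIndepRows p → LinIndepRows reduced
    reduced-linIndep indep μ μ-dep s =
      trans (sym (insertAt-punchIn μ r (- S) s)) (indep w w-dep (punchIn r s))
      where
      open ≡-Reasoning
      S : ℚ
      S = sumF (λ s → μ s * factor s)
      w : Fin (suc m) → ℚ
      w = insertAt μ r (- S)
      T : Fin (suc N) → ℚ
      T i = sumF (λ s → μ s * p (punchIn r s) i)
      split : ∀ i → sumF (λ j → w j * p j i) ≡ - S * p r i + T i
      split i = trans (sumF-punchIn (λ j → w j * p j i) r)
        (cong₂ _+_ (cong (_* p r i) (insertAt-lookup μ r (- S)))
                   (sumF-cong (λ s → cong (_* p (punchIn r s) i) (insertAt-punchIn μ r (- S) s))))
      S≡ : S ≡ T zero * 1/ p r zero
      S≡ = trans (sumF-cong (λ s → sym (*-assoc (μ s) (p (punchIn r s) zero) _)))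
                 (sumF-*ʳ (1/ p r zero) (λ s → μ s * p (punchIn r s) zero))
      w-dep : ∀ i → sumF (λ j → w j * p j i) ≡ 0ℚ
      w-dep zero = begin
        sumF (λ j → w j * p j zero)          ≡⟨ split zero ⟩
        - S * h + T zero                      ≡⟨ cong (λ z → - z * h + T zero) S≡ ⟩
        - (T zero * 1/ h) * h + T zero        ≡⟨ solve 3 (λ t a b → (:- (t :* a)) :* b :+ t := t :- t :* (a :* b))
                                                     refl (T zero) (1/ h) h ⟩
        T zero - T zero * (1/ h * h)          ≡⟨ cong (λ z → T zero - T zero * z) (*-inverseˡ h) ⟩
        T zero - T zero * 1ℚ                  ≡⟨ solve 1 (λ t → t :- t :* con 1ℚ := con 0ℚ) refl (T zero) ⟩
        0ℚ                                    ∎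
        where h = p r zero
      w-dep (suc i) = begin
        sumF (λ j → w j * p j (suc i))
          ≡⟨ split (suc i) ⟩
        - S * B + T (suc i)
          ≡⟨ solve 3 (λ s b t → :- s :* b :+ t := t :+ s :* (:- b)) refl S B (T (suc i)) ⟩
        T (suc i) + S * - B
          ≡⟨ cong (T (suc i) +_) (sym (sumF-*ʳ (- B) (λ s → μ s * factor s))) ⟩
        T (suc i) + sumF (λ s → μ s * factor s * - B)
          ≡⟨ sym (sumF-+ (λ s → μ s * p (punchIn r s) (suc i)) (λ s → μ s * factor s * - B)) ⟩
        sumF (λ s → μ s * p (punchIn r s) (suc i) + μ s * factor s * - B)
          ≡⟨ sumF-cong (λ s → solve 4 (λ m a c b → m :* a :+ m :* c :* (:- b) := m :* (a :- c :* b))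
                                      refl (μ s) (p (punchIn r s) (suc i)) (factor s) B) ⟩
        sumF (λ s → μ s * reduced s i)
          ≡⟨ μ-dep i ⟩
        0ℚ ∎
        where B = p r (suc i)

  rows>cols⇒¬linIndep : ∀ N {m} → N ℕ.< m → (p : Matrix m N) → ¬ LinIndepRows p
  rows>cols⇒¬linIndep zero    {suc m} _ p indep = 1≢0 (indep (λ _ → 1ℚ) (λ ()) zero)
  rows>cols⇒¬linIndep (suc N) {suc m} (s≤s N<m) p indep with any? (λ r → ¬? (p r zero ℚ.≟ 0ℚ))
  ... | yes (r , pivot≢0) = rows>cols⇒¬linIndep N N<m (reduced p r pivot≢0) (reduced-linIndep p r pivot≢0 indep)
    where open Elimination
  ... | no no-pivot = rows>cols⇒¬linIndep N (ℕ.m<n⇒m<1+n N<m) (λ j i → p j (suc i)) tail-indep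
    where
    column₀≡0 : ∀ r → p r zero ≡ 0ℚ
    column₀≡0 r with p r zero ℚ.≟ 0ℚ
    ... | yes eq = eq
    ... | no neq = ⊥-elim (no-pivot (r , neq))
    tail-indep : LinIndepRows (λ j i → p j (suc i))
    tail-indep w w-dep = indep w λ where
      zero    → sumF-vanishing (λ j → trans (cong (w j *_) (column₀≡0 j)) (*-zeroʳ (w j)))
      (suc i) → w-dep i

  rows>cols+1⇒¬affIndep : ∀ N {m} → suc N ℕ.< m → (p : Matrix m N) → ¬ AffIndepRows p
  rows>cols+1⇒¬affIndep N lt p indep = rows>cols⇒¬linIndep (suc N) lt (λ j → 1ℚ ∷ᶠ p j) homogeneous-indep
    where
    homogeneous-indep : LinIndepRows (λ j → 1ℚ ∷ᶠ p j)
    homogeneous-indep w w-dep =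
      indep w (trans (sumF-cong (λ j → sym (*-identityʳ (w j)))) (w-dep zero)) (w-dep ∘ suc)

  affIndep-columns : ∀ {m N N′} (p : Matrix m N) (q : Matrix m N′) (φ : Fin N → Fin N′) →
                     (∀ t i → q t (φ i) ≡ p t i) → AffIndepRows p → AffIndepRows q
  affIndep-columns p q φ eq indep w w-sum w-dep =
    indep w w-sum (λ i → trans (sumF-cong (λ j → cong (w j *_) (sym (eq j i)))) (w-dep (φ i)))

  affIndep-cong : ∀ {m N} {p q : Matrix m N} → (∀ t i → p t i ≡ q t i) → AffIndepRows p → AffIndepRows q
  affIndep-cong {p = p} {q} eq = affIndep-columns p q id (λ t i → sym (eq t i))

  affIndep-single : ∀ {N} (p : Matrix 1 N) → AffIndepRows p
  affIndep-single p w w-sum _ zero = trans (sym (+-identityʳ (w zero))) w-sum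

  record AffineForm (N : ℕ) : Set where
    constructor affineForm
    field
      constant    : ℚ
      coefficient : Fin N → ℚ

  eval : ∀ {N} → AffineForm N → (Fin N → ℚ) → ℚ
  eval (affineForm β₀ β) x = β₀ + sumF (λ i → β i * x i)

  eval-dependence : ∀ {m N} (φ : AffineForm N) (p : Matrix m N) (w : Fin m → ℚ) → sumF w ≡ 0ℚ →
                    (∀ i → sumF (λ j → w j * p j i) ≡ 0ℚ) → sumF (λ j → w j * eval φ (p j)) ≡ 0ℚ
  eval-dependence (affineForm β₀ β) p w w-sum w-dep = begin
    sumF (λ j → w j * (β₀ + sumF (λ i → β i * p j i)))
      ≡⟨ sumF-cong (λ j → trans (*-distribˡ-+ (w j) β₀ _)
                                (cong₂ _+_ (*-comm (w j) β₀) (sym (sumF-*ˡ (w j) (λ i → β i * p j i))))) ⟩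
    sumF (λ j → β₀ * w j + sumF (λ i → w j * (β i * p j i)))
      ≡⟨ sumF-+ (λ j → β₀ * w j) (λ j → sumF (λ i → w j * (β i * p j i))) ⟩
    sumF (λ j → β₀ * w j) + sumF (λ j → sumF (λ i → w j * (β i * p j i)))
      ≡⟨ cong₂ _+_ (sumF-*ˡ β₀ w) (sumF-comm (λ j i → w j * (β i * p j i))) ⟩
    β₀ * sumF w + sumF (λ i → sumF (λ j → w j * (β i * p j i)))
      ≡⟨ cong₂ _+_ (trans (cong (β₀ *_) w-sum) (*-zeroʳ β₀)) (sumF-vanishing column-vanishes) ⟩
    0ℚ + 0ℚ
      ≡⟨ +-identityˡ 0ℚ ⟩
    0ℚ ∎
    where
    open ≡-Reasoning
    column-vanishes : ∀ i → sumF (λ j → w j * (β i * p j i)) ≡ 0ℚ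
    column-vanishes i = begin
      sumF (λ j → w j * (β i * p j i)) ≡⟨ sumF-cong (λ j → solve 3 (λ a b c → a :* (b :* c) := b :* (a :* c))
                                                                refl (w j) (β i) (p j i)) ⟩
      sumF (λ j → β i * (w j * p j i)) ≡⟨ sumF-*ˡ (β i) (λ j → w j * p j i) ⟩
      β i * sumF (λ j → w j * p j i)   ≡⟨ cong (β i *_) (w-dep i) ⟩
      β i * 0ℚ                         ≡⟨ *-zeroʳ (β i) ⟩
      0ℚ                               ∎

  affIndep-∷ : ∀ {m N} (φ : AffineForm N) (q : Fin N → ℚ) (p : Matrix m N) →
               (∀ t → eval φ (p t) ≡ 0ℚ) → eval φ q ≢ 0ℚ → AffIndepRows p → AffIndepRows (q ∷ᶠ p)
  affIndep-∷ {m} φ q p φp≡0 φq≢0 indep w w-sum w-dep = w≡0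
    where
    open ≡-Reasoning
    w₀≡0 : w zero ≡ 0ℚ
    w₀≡0 = *-cancelʳ-≡0 (w zero) (eval φ q) (begin
      w zero * eval φ q
        ≡⟨ sym (+-identityʳ _) ⟩
      w zero * eval φ q + 0ℚ
        ≡⟨ cong (w zero * eval φ q +_)
                (sym (sumF-vanishing (λ t → trans (cong (w (suc t) *_) (φp≡0 t)) (*-zeroʳ (w (suc t)))))) ⟩
      sumF (λ j → w j * eval φ ((q ∷ᶠ p) j))
        ≡⟨ eval-dependence φ (q ∷ᶠ p) w w-sum w-dep ⟩
      0ℚ ∎) φq≢0
    w≡0 : ∀ j → w j ≡ 0ℚ
    w≡0 zero    = w₀≡0
    w≡0 (suc t) = indep (w ∘ suc) (+-cancelˡ-≡0 w₀≡0 w-sum)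
      (λ i → +-cancelˡ-≡0 (trans (cong (_* q i) w₀≡0) (*-zeroˡ (q i))) (w-dep i)) t

  affIndep-dropColumn : ∀ {m N} (p : Matrix m (suc N)) (r : Fin (suc N)) (φ : AffineForm N) →
                        (∀ t → p t r ≡ eval φ (p t ∘ punchIn r)) →
                        AffIndepRows p → AffIndepRows (λ t → p t ∘ punchIn r)
  affIndep-dropColumn p r φ column-r indep w w-sum w-dep = indep w w-sum all-columns
    where
    all-columns : ∀ i → sumF (λ j → w j * p j i) ≡ 0ℚ
    all-columns i with r Fin.≟ i
    ... | yes refl = trans (sumF-cong (λ j → cong (w j *_) (column-r j)))
                           (eval-dependence φ (λ t → p t ∘ punchIn r) w w-sum w-dep)
    ... | no r≢i   = subst (λ c → sumF (λ j → w j * p j c) ≡ 0ℚ) (punchIn-punchOut r≢i) (w-dep (punchOut r≢i))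

  lookup-combination : ∀ {m n} (w : Fin m → ℚ) (p : Fin m → Vec ℚ n) i →
                       lookup (sumV (λ j → scale (w j) (p j))) i ≡ sumF (λ j → w j * lookup (p j) i)
  lookup-combination {zero}  w p i = Vec.lookup-replicate i 0ℚ
  lookup-combination {suc m} w p i =
    trans (Vec.lookup-zipWith _+_ i (scale (w zero) (p zero)) _)
          (cong₂ _+_ (Vec.lookup-map i (w zero *_) (p zero)) (lookup-combination (w ∘ suc) (p ∘ suc) i))

  lookup-ext : ∀ {A : Set} {n} {u v : Vec A n} → (∀ i → lookup u i ≡ lookup v i) → u ≡ v
  lookup-ext {u = u} {v} eq =
    trans (sym (Vec.tabulate∘lookup u)) (trans (Vec.tabulate-cong eq) (Vec.tabulate∘lookup v))

  affIndep⇒rows : ∀ {m n} (p : Fin m → Vec ℚ n) → AffIndep p → AffIndepRows (lookup ∘ p)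
  affIndep⇒rows p indep w w-sum w-dep = indep w w-sum (lookup-ext λ i →
    trans (lookup-combination w p i) (trans (w-dep i) (sym (Vec.lookup-replicate i 0ℚ))))

  rows⇒affIndep : ∀ {m n} (p : Fin m → Vec ℚ n) → AffIndepRows (lookup ∘ p) → AffIndep p
  rows⇒affIndep p indep w w-sum combination≡0 = indep w w-sum λ i →
    trans (sym (lookup-combination w p i))
          (trans (cong (λ v → lookup v i) combination≡0) (Vec.lookup-replicate i 0ℚ))

  eval-δ : ∀ {n} β₀ (c : Fin n) x → eval (affineForm β₀ (δ c)) x ≡ β₀ + x c
  eval-δ β₀ c x = cong (β₀ +_) (sumF-δ c x)

  value : ∀ {n} → Vec ℚ n → Vec Bool n → ℚ
  value a v = dot a (Vec.map b2q v)

  value-true∷ : ∀ {n} x (a : Vec ℚ n) v → value (x ∷ a) (true ∷ v) ≡ x + value a v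
  value-true∷ x a v = cong (_+ value a v) (*-identityʳ x)

  value-false∷ : ∀ {n} x (a : Vec ℚ n) v → value (x ∷ a) (false ∷ v) ≡ value a v
  value-false∷ x a v = trans (cong (_+ value a v) (*-zeroʳ x)) (+-identityˡ (value a v))

  value-set-true : ∀ {n} (a : Vec ℚ n) v l → lookup v l ≡ false →
                   value a (v [ l ]≔ true) ≡ value a v + lookup a l
  value-set-true (x ∷ a) (false ∷ v) zero    _  = trans (value-true∷ x a v)
    (trans (+-comm x (value a v)) (cong (_+ x) (sym (value-false∷ x a v))))
  value-set-true (x ∷ a) (b ∷ v)     (suc l) vₗ = trans (cong (x * b2q b +_) (value-set-true a v l vₗ))
    (sym (+-assoc (x * b2q b) (value a v) (lookup a l)))

  value-set-false : ∀ {n} (a : Vec ℚ n) v l → lookup v l ≡ true →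
                    value a (v [ l ]≔ false) + lookup a l ≡ value a v
  value-set-false (x ∷ a) (true ∷ v) zero    _  = trans (cong (_+ x) (value-false∷ x a v))
    (trans (+-comm (value a v) x) (sym (value-true∷ x a v)))
  value-set-false (x ∷ a) (b ∷ v)    (suc l) vₗ = trans (+-assoc (x * b2q b) _ (lookup a l))
    (cong (x * b2q b +_) (value-set-false a v l vₗ))

  ∣∣-set-true : ∀ {n} (v : Vec Bool n) l → lookup v l ≡ false → ∣ v [ l ]≔ true ∣ ≡ suc ∣ v ∣
  ∣∣-set-true (false ∷ v) zero    _  = refl
  ∣∣-set-true (true ∷ v)  (suc l) vₗ = cong suc (∣∣-set-true v l vₗ)
  ∣∣-set-true (false ∷ v) (suc l) vₗ = ∣∣-set-true v l vₗ

  ∣∣-set-false : ∀ {n} (v : Vec Bool n) l → lookup v l ≡ true → suc ∣ v [ l ]≔ false ∣ ≡ ∣ v ∣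
  ∣∣-set-false (true ∷ v)  zero    _  = refl
  ∣∣-set-false (true ∷ v)  (suc l) vₗ = cong suc (∣∣-set-false v l vₗ)
  ∣∣-set-false (false ∷ v) (suc l) vₗ = ∣∣-set-false v l vₗ

  ∣u∣<∣v∣⇒v⊈u : ∀ {n} (u v : Vec Bool n) → ∣ u ∣ ℕ.< ∣ v ∣ →
                ∃[ l ] lookup v l ≡ true × lookup u l ≡ false
  ∣u∣<∣v∣⇒v⊈u (false ∷ u) (true ∷ v)  _  = zero , refl , refl
  ∣u∣<∣v∣⇒v⊈u (true ∷ u)  (true ∷ v)  lt = Product.map suc id (∣u∣<∣v∣⇒v⊈u u v (ℕ.≤-pred lt))
  ∣u∣<∣v∣⇒v⊈u (true ∷ u)  (false ∷ v) lt = Product.map suc id (∣u∣<∣v∣⇒v⊈u u v (ℕ.<⇒≤ lt))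
  ∣u∣<∣v∣⇒v⊈u (false ∷ u) (false ∷ v) lt = Product.map suc id (∣u∣<∣v∣⇒v⊈u u v lt)

  ∣++∣ : ∀ {m n} (u : Vec Bool m) (v : Vec Bool n) → ∣ u Vec.++ v ∣ ≡ ∣ u ∣ ℕ.+ ∣ v ∣
  ∣++∣ []          v = refl
  ∣++∣ (true ∷ u)  v = cong suc (∣++∣ u v)
  ∣++∣ (false ∷ u) v = ∣++∣ u v

  ∣++∣≡ : ∀ {m n} (u : Vec Bool m) (w : Vec Bool n) {K} →
          ∣ u ∣ ℕ.≤ K → ∣ w ∣ ≡ K ∸ ∣ u ∣ → ∣ u Vec.++ w ∣ ≡ K
  ∣++∣≡ u w ∣u∣≤K ∣w∣≡ = trans (∣++∣ u w) (trans (cong (∣ u ∣ ℕ.+_) ∣w∣≡) (ℕ.m+[n∸m]≡n ∣u∣≤K))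

  ∣∷∣-cong : ∀ {n} b (u w : Vec Bool n) → ∣ u ∣ ≡ ∣ w ∣ → ∣ b ∷ u ∣ ≡ ∣ b ∷ w ∣
  ∣∷∣-cong true  _ _ eq = cong suc eq
  ∣∷∣-cong false _ _ eq = eq

  ∣insertAt∣ : ∀ {n} (v : Vec Bool n) j b → ∣ Vec.insertAt v j b ∣ ≡ ∣ b ∷ v ∣
  ∣insertAt∣ v       zero    b     = refl
  ∣insertAt∣ (x ∷ v) (suc j) b     with ∣insertAt∣ v j b
  ∣insertAt∣ (true ∷ v)  (suc j) true  | eq = cong suc eq
  ∣insertAt∣ (true ∷ v)  (suc j) false | eq = cong suc eq
  ∣insertAt∣ (false ∷ v) (suc j) true  | eq = eq
  ∣insertAt∣ (false ∷ v) (suc j) false | eq = eq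

  insertAt₂ : ∀ {A : Set} {n} {j l : Fin (suc (suc n))} → j ≢ l → Vec A n → A → A → Vec A (suc (suc n))
  insertAt₂ {j = j} j≢l w a b = Vec.insertAt (Vec.insertAt w (punchOut j≢l) b) j a

  lookup-insertAt₂ˡ : ∀ {A : Set} {n} {j l : Fin (suc (suc n))} (j≢l : j ≢ l) (w : Vec A n) a b →
                      lookup (insertAt₂ j≢l w a b) j ≡ a
  lookup-insertAt₂ˡ {j = j} j≢l w a b = Vec.insertAt-lookup (Vec.insertAt w (punchOut j≢l) b) j a

  lookup-insertAt₂ʳ : ∀ {A : Set} {n} {j l : Fin (suc (suc n))} (j≢l : j ≢ l) (w : Vec A n) a b →
                      lookup (insertAt₂ j≢l w a b) l ≡ b
  lookup-insertAt₂ʳ {j = j} j≢l w a b = begin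
    lookup (insertAt₂ j≢l w a b) _
      ≡⟨ cong (lookup (insertAt₂ j≢l w a b)) (punchIn-punchOut j≢l) ⟨
    lookup (insertAt₂ j≢l w a b) (punchIn j (punchOut j≢l))
      ≡⟨ Vec.insertAt-punchIn (Vec.insertAt w (punchOut j≢l) b) j a (punchOut j≢l) ⟩
    lookup (Vec.insertAt w (punchOut j≢l) b) (punchOut j≢l)
      ≡⟨ Vec.insertAt-lookup w (punchOut j≢l) b ⟩
    b ∎
    where open ≡-Reasoning

  ∣insertAt₂∣ : ∀ {n} {j l : Fin (suc (suc n))} (j≢l : j ≢ l) (w : Vec Bool n) a b →
                ∣ insertAt₂ j≢l w a b ∣ ≡ ∣ a ∷ b ∷ w ∣
  ∣insertAt₂∣ {j = j} j≢l w a b =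
    trans (∣insertAt∣ w′ j a) (∣∷∣-cong a w′ (b ∷ w) (∣insertAt∣ w (punchOut j≢l) b))
    where w′ = Vec.insertAt w (punchOut j≢l) b

  value-raiseHead : ∀ {n} x (a : Vec ℚ n) (u : Vec Bool (suc n)) →
                    value ((x + 1ℚ) ∷ a) u ≡ value (x ∷ a) u + b2q (lookup u zero)
  value-raiseHead x a (b ∷ u) =
    solve 3 (λ x y v → (x :+ con 1ℚ) :* y :+ v := x :* y :+ v :+ y) refl x (b2q b) (value a u)

  someSubset : ∀ k n → k ℕ.≤ n → Σ (Vec Bool n) λ v → ∣ v ∣ ≡ k
  someSubset zero    zero    _         = [] , refl
  someSubset zero    (suc n) _         = Product.map (false ∷_) id (someSubset zero n z≤n)
  someSubset (suc k) (suc n) (s≤s k≤n) = Product.map (true ∷_) (cong suc) (someSubset k n k≤n)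

  -- Minimisers of a linear functional on the vertices of Δ(k,n)

  Minimiser : ∀ {n} → ℕ → Vec ℚ n → Vec Bool n → Set
  Minimiser {n} k a u = ∣ u ∣ ≡ k × ((v : Vec Bool n) → ∣ v ∣ ≡ k → value a u ≤ value a v)

  Lightest : ∀ {n} → Vec ℚ n → Vec Bool n → Set
  Lightest a u = ∀ i l → lookup u i ≡ true → lookup u l ≡ false → lookup a i ≤ lookup a l

  minimiser-exchange : ∀ {n k} {a : Vec ℚ n} {z i l} → Minimiser k a z →
                       lookup z i ≡ true → lookup z l ≡ false → lookup a i ≤ lookup a l
  minimiser-exchange {k = k} {a} {z} {i} {l} (∣z∣≡k , z-min) zᵢ zₗ = +-cancelˡ-≤ (value a z) (begin
    value a z + lookup a i   ≤⟨ +-monoˡ-≤ (lookup a i) (z-min z″ ∣z″∣≡k) ⟩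
    value a z″ + lookup a i  ≡⟨ value-set-false a z′ i z′ᵢ ⟩
    value a z′               ≡⟨ value-set-true a z l zₗ ⟩
    value a z + lookup a l   ∎)
    where
    open ≤-Reasoning
    i≢l : i ≢ l
    i≢l refl with trans (sym zᵢ) zₗ
    ... | ()
    z′ z″ : Vec Bool _
    z′ = z [ l ]≔ true
    z″ = z′ [ i ]≔ false
    z′ᵢ : lookup z′ i ≡ true
    z′ᵢ = trans (Vec.lookup∘update′ i≢l z true) zᵢ
    ∣z″∣≡k : ∣ z″ ∣ ≡ k
    ∣z″∣≡k = ℕ.suc-injective
      (trans (∣∣-set-false z′ i z′ᵢ) (trans (∣∣-set-true z l zₗ) (cong suc ∣z∣≡k)))

  minimisers-exchange : ∀ {n k} {a : Vec ℚ n} {p q i l} → Minimiser k a p → Minimiser k a q →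
                        lookup p i ≡ true → lookup q l ≡ false → lookup a i ≤ lookup a l
  minimisers-exchange {a = a} {p} {q} {i} {l} p-min q-min pᵢ qₗ with lookup q i in qᵢ
  ... | true  = minimiser-exchange {a = a} {q} q-min qᵢ qₗ
  ... | false with ∣u∣<∣v∣⇒v⊈u (p [ i ]≔ false) q (ℕ.≤-reflexive ∣p′∣<∣q∣)
    where
    ∣p′∣<∣q∣ : suc ∣ p [ i ]≔ false ∣ ≡ ∣ q ∣
    ∣p′∣<∣q∣ = trans (∣∣-set-false p i pᵢ) (trans (proj₁ p-min) (sym (proj₁ q-min)))
  ...   | m , qₘ , p′ₘ =
    ≤-trans (minimiser-exchange {a = a} {p} p-min pᵢ pₘ) (minimiser-exchange {a = a} {q} q-min qₘ qₗ)
    where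
    m≢i : m ≢ i
    m≢i refl with trans (sym qₘ) qᵢ
    ... | ()
    pₘ : lookup p m ≡ false
    pₘ = trans (sym (Vec.lookup∘update′ m≢i p false)) p′ₘ

  lightest-tail : ∀ {n} {x b} {a : Vec ℚ n} {u} → Lightest (x ∷ a) (b ∷ u) → Lightest a u
  lightest-tail light i l = light (suc i) (suc l)

  lightest-minimal : ∀ {n} (a : Vec ℚ n) u v → Lightest a u → ∣ u ∣ ≡ ∣ v ∣ → value a u ≤ value a v
  lightest-minimal [] [] [] _ _ = ≤-refl
  lightest-minimal (x ∷ a) (true ∷ u) (true ∷ v) light eq = begin
    value (x ∷ a) (true ∷ u)  ≡⟨ value-true∷ x a u ⟩
    x + value a u             ≤⟨ +-monoʳ-≤ x (lightest-minimal a u v (lightest-tail light) (ℕ.suc-injective eq)) ⟩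
    x + value a v             ≡⟨ value-true∷ x a v ⟨
    value (x ∷ a) (true ∷ v)  ∎
    where open ≤-Reasoning
  lightest-minimal (x ∷ a) (false ∷ u) (false ∷ v) light eq = begin
    value (x ∷ a) (false ∷ u)  ≡⟨ value-false∷ x a u ⟩
    value a u                  ≤⟨ lightest-minimal a u v (lightest-tail light) eq ⟩
    value a v                  ≡⟨ value-false∷ x a v ⟨
    value (x ∷ a) (false ∷ v)  ∎
    where open ≤-Reasoning
  lightest-minimal (x ∷ a) (true ∷ u) (false ∷ v) light eq
    with ∣u∣<∣v∣⇒v⊈u u v (ℕ.≤-reflexive eq)
  ... | l , vₗ , uₗ = begin
    value (x ∷ a) (true ∷ u)   ≡⟨ value-true∷ x a u ⟩
    x + value a u              ≤⟨ +-monoʳ-≤ x (lightest-minimal a u v′ (lightest-tail light) ∣u∣≡∣v′∣) ⟩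
    x + value a v′             ≤⟨ +-monoˡ-≤ (value a v′) (light zero (suc l) refl uₗ) ⟩
    lookup a l + value a v′    ≡⟨ +-comm (lookup a l) (value a v′) ⟩
    value a v′ + lookup a l    ≡⟨ value-set-false a v l vₗ ⟩
    value a v                  ≡⟨ value-false∷ x a v ⟨
    value (x ∷ a) (false ∷ v)  ∎
    where
    open ≤-Reasoning
    v′ = v [ l ]≔ false
    ∣u∣≡∣v′∣ : ∣ u ∣ ≡ ∣ v′ ∣
    ∣u∣≡∣v′∣ = ℕ.suc-injective (trans eq (sym (∣∣-set-false v l vₗ)))
  lightest-minimal (x ∷ a) (false ∷ u) (true ∷ v) light eq
    with ∣u∣<∣v∣⇒v⊈u v u (ℕ.≤-reflexive (sym eq))
  ... | l , uₗ , vₗ = begin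
    value (x ∷ a) (false ∷ u)  ≡⟨ value-false∷ x a u ⟩
    value a u                  ≤⟨ lightest-minimal a u v′ (lightest-tail light) ∣u∣≡∣v′∣ ⟩
    value a v′                 ≡⟨ value-set-true a v l vₗ ⟩
    value a v + lookup a l     ≤⟨ +-monoʳ-≤ (value a v) (light (suc l) zero uₗ refl) ⟩
    value a v + x              ≡⟨ +-comm (value a v) x ⟩
    x + value a v              ≡⟨ value-true∷ x a v ⟨
    value (x ∷ a) (true ∷ v)   ∎
    where
    open ≤-Reasoning
    v′ = v [ l ]≔ true
    ∣u∣≡∣v′∣ : ∣ u ∣ ≡ ∣ v′ ∣
    ∣u∣≡∣v′∣ = trans eq (sym (∣∣-set-true v l vₗ))

  agreeing⇒minimiser : ∀ {n k} {a : Vec ℚ n} {u} → ∣ u ∣ ≡ k →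
                       (∀ j → ∃[ y ] Minimiser k a y × lookup y j ≡ lookup u j) → Minimiser k a u
  agreeing⇒minimiser {a = a} {u} ∣u∣≡k agree =
    ∣u∣≡k , λ v ∣v∣≡k → lightest-minimal a u v lightest (trans ∣u∣≡k (sym ∣v∣≡k))
    where
    lightest : Lightest a u
    lightest i l uᵢ uₗ with agree i | agree l
    ... | p , p-min , pᵢ | q , q-min , qₗ =
      minimisers-exchange {a = a} {p} {q} p-min q-min (trans pᵢ uᵢ) (trans qₗ uₗ)

  vertex : ∀ k n → Fin (N k n) → Vec Bool n
  vertex k n = List.lookup (hyperVerts k n)

  ∈-hyperVerts⇒∣∣ : ∀ k n {v} → v ∈ₗ hyperVerts k n → ∣ v ∣ ≡ k
  ∈-hyperVerts⇒∣∣ zero    zero    (here refl) = refl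
  ∈-hyperVerts⇒∣∣ zero    (suc n) v∈ with ∈-map⁻ (false ∷_) v∈
  ... | _ , v′∈ , refl = ∈-hyperVerts⇒∣∣ zero n v′∈
  ∈-hyperVerts⇒∣∣ (suc k) (suc n) v∈ with ∈-++⁻ (map (true ∷_) (hyperVerts k n)) v∈
  ... | inj₁ v∈₁ with ∈-map⁻ (true ∷_) v∈₁
  ...   | _ , v′∈ , refl = cong suc (∈-hyperVerts⇒∣∣ k n v′∈)
  ∈-hyperVerts⇒∣∣ (suc k) (suc n) v∈ | inj₂ v∈₂ with ∈-map⁻ (false ∷_) v∈₂
  ...   | _ , v′∈ , refl = ∈-hyperVerts⇒∣∣ (suc k) n v′∈

  ∣∣⇒∈-hyperVerts : ∀ k n (v : Vec Bool n) → ∣ v ∣ ≡ k → v ∈ₗ hyperVerts k n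
  ∣∣⇒∈-hyperVerts zero    zero    []          _  = here refl
  ∣∣⇒∈-hyperVerts zero    (suc n) (false ∷ v) eq = ∈-map⁺ (false ∷_) (∣∣⇒∈-hyperVerts zero n v eq)
  ∣∣⇒∈-hyperVerts (suc k) (suc n) (true ∷ v)  eq =
    ∈-++⁺ˡ (∈-map⁺ (true ∷_) (∣∣⇒∈-hyperVerts k n v (ℕ.suc-injective eq)))
  ∣∣⇒∈-hyperVerts (suc k) (suc n) (false ∷ v) eq =
    ∈-++⁺ʳ (map (true ∷_) (hyperVerts k n)) (∈-map⁺ (false ∷_) (∣∣⇒∈-hyperVerts (suc k) n v eq))

  ∣vertex∣ : ∀ k n i → ∣ vertex k n i ∣ ≡ k
  ∣vertex∣ k n i = ∈-hyperVerts⇒∣∣ k n (∈-lookup i)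

  vertexIndex : ∀ {k n} (v : Vec Bool n) → ∣ v ∣ ≡ k → Fin (N k n)
  vertexIndex {k} {n} v eq = Any.index (∣∣⇒∈-hyperVerts k n v eq)

  vertex-vertexIndex : ∀ {k n} (v : Vec Bool n) (eq : ∣ v ∣ ≡ k) → vertex k n (vertexIndex v eq) ≡ v
  vertex-vertexIndex {k} {n} v eq = sym (lookup-index (∣∣⇒∈-hyperVerts k n v eq))

  N≡choose : ∀ k n → N k n ≡ n choose k
  N≡choose zero    zero    = refl
  N≡choose (suc k) zero    = refl
  N≡choose zero    (suc n) = trans (List.length-map (false ∷_) (hyperVerts zero n)) (N≡choose zero n)
  N≡choose (suc k) (suc n) = begin
    length (map (true ∷_) (hyperVerts k n) ++ map (false ∷_) (hyperVerts (suc k) n))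
      ≡⟨ List.length-++ (map (true ∷_) (hyperVerts k n)) ⟩
    length (map (true ∷_) (hyperVerts k n)) ℕ.+ length (map (false ∷_) (hyperVerts (suc k) n))
      ≡⟨ cong₂ ℕ._+_ (trans (List.length-map (true ∷_) (hyperVerts k n)) (N≡choose k n))
                     (trans (List.length-map (false ∷_) (hyperVerts (suc k) n)) (N≡choose (suc k) n)) ⟩
    n choose k ℕ.+ n choose suc k
      ≡⟨ nCk+nC[k+1]≡[n+1]C[k+1] n k ⟩
    suc n choose suc k ∎
    where open ≡-Reasoning

  head-false-block : ∀ {n} (ys : List (Vec Bool n)) i → lookup (List.lookup (map (false ∷_) ys) i) zero ≡ false
  head-false-block (y ∷ ys) zero    = refl
  head-false-block (y ∷ ys) (suc i) = head-false-block ys i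

  firstCoordinate-blocks : ∀ {n} (xs ys : List (Vec Bool n)) {u} → u ∈ₗ xs → ∀ i →
    b2q (toℕ i <ᵇ length xs ∸ 1) + b2q (toℕ i ℕ.≡ᵇ length xs ∸ 1)
      ≡ b2q (lookup (List.lookup (map (true ∷_) xs ++ map (false ∷_) ys) i) zero)
  firstCoordinate-blocks (x ∷ [])      ys _ zero    = +-identityˡ 1ℚ
  firstCoordinate-blocks (x ∷ [])      ys _ (suc i) = trans (+-identityˡ 0ℚ) (cong b2q (sym (head-false-block ys i)))
  firstCoordinate-blocks (x ∷ x′ ∷ xs) ys _ zero    = +-identityʳ 1ℚ
  firstCoordinate-blocks (x ∷ x′ ∷ xs) ys _ (suc i) = firstCoordinate-blocks (x′ ∷ xs) ys (here refl) i

  -- Affinely independent vertices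

  row : ∀ {n} → Vec Bool n → Fin n → ℚ
  row u i = b2q (lookup u i)

  dot-tabulate : ∀ {n} (f : Fin n → ℚ) (u : Vec Bool n) →
                 dot (tabulate f) (Vec.map b2q u) ≡ sumF (λ i → f i * row u i)
  dot-tabulate f []      = refl
  dot-tabulate f (b ∷ u) = cong (f zero * b2q b +_) (dot-tabulate (f ∘ suc) u)

  IndependentIn : ∀ k n → Subset (N k n) → ℕ → Set
  IndependentIn k n S m = Σ (Fin m → Fin (N k n)) λ ix → (∀ t → ix t ∈ S) × AffIndep (λ t → vert k n (ix t))

  rows : ∀ {m n} → (Fin m → Vec Bool n) → Matrix m n
  rows P t = row (P t)

  affIndep-insertAt : ∀ {m n} (P : Fin m → Vec Bool n) j b →
                      AffIndepRows (rows P) → AffIndepRows (rows (λ t → Vec.insertAt (P t) j b))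
  affIndep-insertAt P j b = affIndep-columns (rows P) (rows (λ t → Vec.insertAt (P t) j b)) (punchIn j)
    (λ t i → cong b2q (Vec.insertAt-punchIn (P t) j b i))

  affIndep-insertAt₂ : ∀ {m n} {j l : Fin (suc (suc n))} (j≢l : j ≢ l) (P : Fin m → Vec Bool n) a b →
                       AffIndepRows (rows P) → AffIndepRows (rows (λ t → insertAt₂ j≢l (P t) a b))
  affIndep-insertAt₂ {j = j} j≢l P a b indep =
    affIndep-insertAt (λ t → Vec.insertAt (P t) (punchOut j≢l) b) j a (affIndep-insertAt P (punchOut j≢l) b indep)

  affIndep-∷-vertex : ∀ {m n} (φ : AffineForm n) (q : Vec Bool n) (P : Fin m → Vec Bool n) →
                      (∀ t → eval φ (rows P t) ≡ 0ℚ) → eval φ (row q) ≢ 0ℚ →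
                      AffIndepRows (rows P) → AffIndepRows (rows (q ∷ᶠ P))
  affIndep-∷-vertex φ q P φP≡0 φq≢0 indep =
    affIndep-cong rows-∷ (affIndep-∷ φ (row q) (rows P) φP≡0 φq≢0 indep)
    where
    rows-∷ : ∀ t i → (row q ∷ᶠ rows P) t i ≡ rows (q ∷ᶠ P) t i
    rows-∷ zero    i = refl
    rows-∷ (suc t) i = refl

  affIndep-∷-private : ∀ {m n} (q : Vec Bool n) (P : Fin m → Vec Bool n) c b →
                       (∀ t → lookup (P t) c ≡ b) → lookup q c ≡ not b →
                       AffIndepRows (rows P) → AffIndepRows (rows (q ∷ᶠ P))
  affIndep-∷-private q P c b Pc≡b qc≡¬b = affIndep-∷-vertex φ q P φP≡0 φq≢0
    where
    φ = affineForm (- b2q b) (δ c)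
    φP≡0 : ∀ t → eval φ (rows P t) ≡ 0ℚ
    φP≡0 t = trans (eval-δ (- b2q b) c (rows P t))
      (trans (cong (λ x → - b2q b + b2q x) (Pc≡b t)) (+-inverseˡ (b2q b)))
    φq≢0 : eval φ (row q) ≢ 0ℚ
    φq≢0 eq = b2q-not≢ b (trans (cong (λ x → - b2q b + b2q x) (sym qc≡¬b))
                                (trans (sym (eval-δ (- b2q b) c (row q))) eq))

  IndependentVertices : ℕ → ℕ → Set
  IndependentVertices t r = Σ (Fin r → Vec Bool r) λ P → (∀ s → ∣ P s ∣ ≡ t) × AffIndepRows (rows P)

  affIndep-prepend : ∀ {m r} b (w : Vec Bool r) (P : Fin m → Vec Bool r) →
                     AffIndepRows (rows P) → AffIndepRows (rows ((b ∷ w) ∷ᶠ λ s → not b ∷ P s))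
  affIndep-prepend b w P indep = affIndep-∷-private (b ∷ w) (λ s → not b ∷ P s) zero (not b)
    (λ _ → refl) (sym (Bool.not-involutive b)) (affIndep-insertAt P zero (not b) indep)

  prepend-true : ∀ {t r} → 1 ℕ.≤ t → t ℕ.≤ r → IndependentVertices t r → IndependentVertices t (suc r)
  prepend-true {t} {r} 1≤t t≤r (P , ∣P∣≡t , indep)
    with someSubset (t ∸ 1) r (ℕ.≤-trans (ℕ.m∸n≤m t 1) t≤r)
  ... | w , ∣w∣≡t-1 = (true ∷ w) ∷ᶠ (λ s → false ∷ P s) , sizes , affIndep-prepend true w P indep
    where
    sizes : ∀ s → ∣ ((true ∷ w) ∷ᶠ λ s → false ∷ P s) s ∣ ≡ t
    sizes zero    = trans (cong suc ∣w∣≡t-1) (ℕ.m+[n∸m]≡n 1≤t)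
    sizes (suc s) = ∣P∣≡t s

  prepend-false : ∀ {t r} → suc t ℕ.≤ r → IndependentVertices t r → IndependentVertices (suc t) (suc r)
  prepend-false {t} {r} t<r (P , ∣P∣≡t , indep) with someSubset (suc t) r t<r
  ... | w , ∣w∣≡t+1 = (false ∷ w) ∷ᶠ (λ s → true ∷ P s) , sizes , affIndep-prepend false w P indep
    where
    sizes : ∀ s → ∣ ((false ∷ w) ∷ᶠ λ s → true ∷ P s) s ∣ ≡ suc t
    sizes zero    = ∣w∣≡t+1
    sizes (suc s) = cong suc (∣P∣≡t s)

  independentVertices : ∀ t r → 1 ℕ.≤ t → t ℕ.< r → IndependentVertices t r
  independentVertices (suc zero)    (suc zero)          _ (s≤s ())
  independentVertices (suc zero)    (suc (suc zero))    _ _ =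
    prepend-true ℕ.≤-refl ℕ.≤-refl
      ((λ _ → true ∷ []) , (λ _ → refl) , affIndep-single (rows (λ _ → true ∷ [])))
  independentVertices (suc zero)    (suc (suc (suc r))) _ _ =
    prepend-true ℕ.≤-refl (s≤s z≤n) (independentVertices 1 (suc (suc r)) ℕ.≤-refl (s≤s (s≤s z≤n)))
  independentVertices (suc (suc t)) (suc r)             _ (s≤s t+2≤r) =
    prepend-false t+2≤r (independentVertices (suc t) r (s≤s z≤n) t+2≤r)

  fromℕ : ℕ → ℚ
  fromℕ zero    = 0ℚ
  fromℕ (suc m) = 1ℚ + fromℕ m

  sumF-row : ∀ {n} (u : Vec Bool n) → sumF (row u) ≡ fromℕ ∣ u ∣
  sumF-row []          = refl
  sumF-row (true ∷ u)  = cong (1ℚ +_) (sumF-row u)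
  sumF-row (false ∷ u) = trans (+-identityˡ _) (sumF-row u)

  firstCoordinateForm : ∀ {n} → ℕ → AffineForm n
  firstCoordinateForm K = affineForm (fromℕ K) (λ _ → - 1ℚ)

  row₀≡ : ∀ {n} (u : Vec Bool (suc n)) → row u zero ≡ eval (firstCoordinateForm ∣ u ∣) (row u ∘ suc)
  row₀≡ (b ∷ u) = begin
    b2q b
      ≡⟨ solve 2 (λ x s → x := x :+ s :+ con (- 1ℚ) :* s) refl (b2q b) (sumF (row u)) ⟩
    b2q b + sumF (row u) + - 1ℚ * sumF (row u)
      ≡⟨ cong₂ _+_ (sumF-row (b ∷ u)) (sym (sumF-*ˡ (- 1ℚ) (row u))) ⟩
    fromℕ ∣ b ∷ u ∣ + sumF (λ i → - 1ℚ * row u i) ∎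
    where open ≡-Reasoning

  -- Δ(K, n + 1) lies in the hyperplane x₀ = K − Σ xᵢ₊₁, so dropping x₀ preserves affine independence.
  vertices-affDep : ∀ {n} K (P : Fin (suc (suc n)) → Vec Bool (suc n)) → (∀ t → ∣ P t ∣ ≡ K) →
                    ¬ AffIndepRows (rows P)
  vertices-affDep {n} K P ∣P∣≡K indep = rows>cols+1⇒¬affIndep n ℕ.≤-refl (λ t → rows P t ∘ suc)
    (affIndep-dropColumn (rows P) zero (firstCoordinateForm K) firstCoordinate indep)
    where
    firstCoordinate : ∀ t → rows P t zero ≡ eval (firstCoordinateForm K) (rows P t ∘ suc)
    firstCoordinate t = subst (λ K′ → rows P t zero ≡ eval (firstCoordinateForm K′) (rows P t ∘ suc))
                              (∣P∣≡K t) (row₀≡ (P t))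

  affIndep⇒vertexRows : ∀ {k n m} (ix : Fin m → Fin (N k n)) →
                        AffIndep (λ t → vert k n (ix t)) → AffIndepRows (rows (vertex k n ∘ ix))
  affIndep⇒vertexRows {k} {n} ix indep =
    affIndep-cong (λ t i → Vec.lookup-map i b2q (vertex k n (ix t))) (affIndep⇒rows (λ t → vert k n (ix t)) indep)

  vertexRows⇒affIndep : ∀ {k n m} (ix : Fin m → Fin (N k n)) (P : Fin m → Vec Bool n) →
                        (∀ t → vertex k n (ix t) ≡ P t) → AffIndepRows (rows P) → AffIndep (λ t → vert k n (ix t))
  vertexRows⇒affIndep {k} {n} ix P ix≡P indep = rows⇒affIndep (λ t → vert k n (ix t)) (affIndep-cong
    (λ t i → sym (trans (Vec.lookup-map i b2q (vertex k n (ix t))) (cong (λ u → b2q (lookup u i)) (ix≡P t))))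
    indep)

  vert-affDep : ∀ {k n} (ix : Fin (suc (suc n)) → Fin (N k (suc n))) → ¬ AffIndep (λ t → vert k (suc n) (ix t))
  vert-affDep {k} {n} ix indep =
    vertices-affDep k (vertex k (suc n) ∘ ix) (∣vertex∣ k (suc n) ∘ ix) (affIndep⇒vertexRows {k} {suc n} ix indep)

  ∈-tabulate⁺ : ∀ {n} (f : Fin n → Bool) i → f i ≡ true → i ∈ tabulate f
  ∈-tabulate⁺ f i fi = Vec.lookup⇒[]= i (tabulate f) (trans (Vec.lookup∘tabulate f i) fi)

  ∈-tabulate⁻ : ∀ {n} (f : Fin n → Bool) i → i ∈ tabulate f → f i ≡ true
  ∈-tabulate⁻ f i i∈ = trans (sym (Vec.lookup∘tabulate f i)) (Vec.[]=⇒lookup i∈)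

  isCell-tabulate : ∀ {k n} (ω : Fin (N k n) → ℚ) (a : Vec ℚ n) c (f : Fin (N k n) → Bool) →
                    (∀ i → dot a (vert k n i) + ω i ≡ c + b2q (not (f i))) → IsCell k n ω (tabulate f)
  isCell-tabulate ω a c f height =
    a , c , (λ i → subst (c ≤_) (sym (height i)) (c≤c+b2q c (not (f i)))) ,
    λ i →
      mk⇔ (λ eq → ∈-tabulate⁺ f i (Equivalence.to (c+b2q-not≡c⇔ c (f i)) (trans (sym (height i)) eq)))
          (λ i∈ → trans (height i) (Equivalence.from (c+b2q-not≡c⇔ c (f i)) (∈-tabulate⁻ f i i∈)))

  isFace-tabulate : ∀ {k n} (S : Subset (N k n)) (b : Vec ℚ n) d (g : Fin (N k n) → Bool) → tabulate g ⊆ S →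
                    (∀ i → i ∈ S → dot b (vert k n i) ≡ d + b2q (not (g i))) → IsFaceOf k n (tabulate g) S
  isFace-tabulate S b d g g⊆S height =
    g⊆S , b , d , (λ i i∈S → subst (d ≤_) (sym (height i i∈S)) (c≤c+b2q d (not (g i)))) ,
    λ i i∈S →
      mk⇔ (λ eq → ∈-tabulate⁺ g i (Equivalence.to (c+b2q-not≡c⇔ d (g i)) (trans (sym (height i i∈S)) eq)))
          (λ i∈ → trans (height i i∈S) (Equivalence.from (c+b2q-not≡c⇔ d (g i)) (∈-tabulate⁻ g i i∈)))

  -- The maximal cells of Δ(k,n)^κ

  module Subdivision (k′ n′ : ℕ) (k′≤n′ : k′ ℕ.≤ n′) where

    k n : ℕ
    k = suc k′
    n = suc n′

    v : Fin (N k n) → Vec Bool n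
    v = vertex k n

    private
      firstBlock-nonempty : proj₁ (someSubset k′ n′ k′≤n′) ∈ₗ hyperVerts k′ n′
      firstBlock-nonempty = ∣∣⇒∈-hyperVerts k′ n′ _ (proj₂ (someSubset k′ n′ k′≤n′))

      0<N : 0 ℕ.< N k′ n′
      0<N with hyperVerts k′ n′ | firstBlock-nonempty
      ... | _ ∷ _ | _ = s≤s z≤n

    -- The paper's v_{C(n-1,k-1)}.
    apex : Fin (N k n)
    apex = Fin.fromℕ< (ℕ.<-≤-trans (ℕ.∸-monoʳ-< (s≤s z≤n) 0<N) firstBlock≤)
      where
      firstBlock≤ : N k′ n′ ℕ.≤ N k n
      firstBlock≤ = ℕ.≤-trans (ℕ.≤-reflexive (sym (List.length-map (true ∷_) (hyperVerts k′ n′))))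
                              (List.length-++-≤ˡ (map (true ∷_) (hyperVerts k′ n′)))

    isApex : Fin (N k n) → Bool
    isApex i = toℕ i ℕ.≡ᵇ N k′ n′ ∸ 1

    isApex-apex : isApex apex ≡ true
    isApex-apex = Equivalence.to Bool.T-≡ (ℕ.≡⇒≡ᵇ (toℕ apex) (N k′ n′ ∸ 1) (toℕ-fromℕ< _))

    isApex⇒≡apex : ∀ i → isApex i ≡ true → i ≡ apex
    isApex⇒≡apex i eq = toℕ-injective
      (trans (ℕ.≡ᵇ⇒≡ _ _ (Equivalence.from Bool.T-≡ eq)) (sym (toℕ-fromℕ< _)))

    κ+isApex : ∀ i → κ k n i + b2q (isApex i) ≡ b2q (lookup (v i) zero)
    κ+isApex i = trans (cong (_+ b2q (isApex i)) κ≡)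
                       (firstCoordinate-blocks (hyperVerts k′ n′) (hyperVerts k n′) firstBlock-nonempty i)
      where
      κ≡ : κ k n i ≡ b2q (toℕ i <ᵇ N k′ n′ ∸ 1)
      κ≡ = trans (if-b2q _) (cong (λ m → b2q (toℕ i <ᵇ m ∸ 1)) (sym (N≡choose k′ n′)))

    apexVertex : Vec Bool n
    apexVertex = v apex

    differs : Fin n → Vec Bool n → Bool
    differs j u = lookup u j xor lookup apexVertex j

    differs-apex : ∀ i j → isApex i ≡ true → differs j (v i) ≡ false
    differs-apex i j eq =
      trans (cong (λ i′ → differs j (v i′)) (isApex⇒≡apex i eq)) (Bool.xor-same (lookup apexVertex j))

    σ τ : Fin n → ℚ
    σ j = if lookup apexVertex j then - 1ℚ else 1ℚ
    τ j = b2q (lookup apexVertex j)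

    τ+σ*b2q : ∀ j u → τ j + σ j * b2q (lookup u j) ≡ b2q (differs j u)
    τ+σ*b2q j u = b2q-xor (lookup u j) (lookup apexVertex j)

    memberC : Fin n → Fin (N k n) → Bool
    memberC j i = isApex i ∨ differs j (v i)

    C : Fin n → Subset (N k n)
    C j = tabulate (memberC j)

    cellNormal : Fin n → Vec ℚ n
    cellNormal j = tabulate (pairCoeff (- 1ℚ) zero (- σ j) j)

    C-height : ∀ j i → dot (cellNormal j) (vert k n i) + κ k n i ≡ (τ j - 1ℚ) + b2q (not (memberC j i))
    C-height j i = begin
      dot (cellNormal j) (vert k n i) + κ k n i
        ≡⟨ cong₂ _+_ (trans (dot-tabulate (pairCoeff (- 1ℚ) zero (- σ j) j) (v i))
                            (sumF-pairCoeff (- 1ℚ) zero (- σ j) j (row (v i))))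
                     (trans (solve 2 (λ x e → x := x :+ e :- e) refl (κ k n i) E) (cong (_- E) (κ+isApex i))) ⟩
      - 1ℚ * H + - σ j * B + (H - E)
        ≡⟨ solve 5 (λ h b s t e → con (- 1ℚ) :* h :+ (:- s) :* b :+ (h :- e) := t :- (t :+ s :* b) :- e)
                   refl H B (σ j) (τ j) E ⟩
      τ j - (τ j + σ j * B) - E
        ≡⟨ cong (λ x → τ j - x - E) (τ+σ*b2q j (v i)) ⟩
      τ j - b2q (differs j (v i)) - E
        ≡⟨ disjoint (isApex i) (differs j (v i)) (differs-apex i j) ⟩
      (τ j - 1ℚ) + b2q (not (memberC j i)) ∎
      where
      open ≡-Reasoning
      H = row (v i) zero
      B = row (v i) j
      E = b2q (isApex i)
      disjoint : ∀ e d → (e ≡ true → d ≡ false) → τ j - b2q d - b2q e ≡ (τ j - 1ℚ) + b2q (not (e ∨ d))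
      disjoint true  true  e⇒¬d with e⇒¬d refl
      ... | ()
      disjoint true  false _ = solve 1 (λ t → t :- con 0ℚ :- con 1ℚ := (t :- con 1ℚ) :+ con 0ℚ) refl (τ j)
      disjoint false true  _ = solve 1 (λ t → t :- con 1ℚ :- con 0ℚ := (t :- con 1ℚ) :+ con 0ℚ) refl (τ j)
      disjoint false false _ = solve 1 (λ t → t :- con 0ℚ :- con 0ℚ := (t :- con 1ℚ) :+ con 1ℚ) refl (τ j)

    C-isCell : ∀ j → IsCell k n (κ k n) (C j)
    C-isCell j = isCell-tabulate {k} {n} (κ k n) (cellNormal j) (τ j - 1ℚ) (memberC j) (C-height j)

    -- As κ = x₀ − [apex] on vertices, raising the first coefficient of the normal of a lower face S by 1
    -- gives a linear functional a⁺ whose minimisers are the vertices of S other than the apex, while it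
    -- exceeds its minimum by at least 1 at the apex.
    module LowerFace {S : Subset (N k n)} (a₀ : ℚ) (a : Vec ℚ n′) (c : ℚ)
                     (below : ∀ i → c ≤ dot (a₀ ∷ a) (vert k n i) + κ k n i)
                     (tight : ∀ i → (dot (a₀ ∷ a) (vert k n i) + κ k n i ≡ c) ⇔ (i ∈ S)) where

      a⁺ : Vec ℚ n
      a⁺ = (a₀ + 1ℚ) ∷ a

      lifted : ∀ i → dot (a₀ ∷ a) (vert k n i) + κ k n i + b2q (isApex i) ≡ value a⁺ (v i)
      lifted i = trans (+-assoc (value (a₀ ∷ a) (v i)) (κ k n i) (b2q (isApex i)))
        (trans (cong (value (a₀ ∷ a) (v i) +_) (κ+isApex i)) (sym (value-raiseHead a₀ a (v i))))

      below⁺ : ∀ i → c + b2q (isApex i) ≤ value a⁺ (v i)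
      below⁺ i = subst (c + b2q (isApex i) ≤_) (lifted i) (+-monoˡ-≤ (b2q (isApex i)) (below i))

      value≡c : ∀ {i} → i ∈ S → isApex i ≡ false → value a⁺ (v i) ≡ c
      value≡c {i} i∈S ¬apex = trans (sym (lifted i))
        (trans (cong₂ _+_ (Equivalence.from (tight i) i∈S) (cong b2q ¬apex)) (+-identityʳ c))

      minimiser : ∀ {i} → i ∈ S → isApex i ≡ false → Minimiser k a⁺ (v i)
      minimiser {i} i∈S ¬apex = ∣vertex∣ k n i , λ u ∣u∣≡k → begin
        value a⁺ (v i)                          ≡⟨ value≡c i∈S ¬apex ⟩
        c                                       ≤⟨ c≤c+b2q c (isApex (vertexIndex u ∣u∣≡k)) ⟩
        c + b2q (isApex (vertexIndex u ∣u∣≡k))  ≤⟨ below⁺ (vertexIndex u ∣u∣≡k) ⟩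
        value a⁺ (v (vertexIndex u ∣u∣≡k))      ≡⟨ cong (value a⁺) (vertex-vertexIndex u ∣u∣≡k) ⟩
        value a⁺ u                              ∎
        where open ≤-Reasoning

      Agreeing : Fin n → Set
      Agreeing j = ∃[ i ] i ∈ S × isApex i ≡ false × lookup (v i) j ≡ lookup apexVertex j

      agreeing? : ∀ j → Dec (Agreeing j)
      agreeing? j =
        any? λ i → (i ∈? S) ×-dec (isApex i Bool.≟ false) ×-dec (lookup (v i) j Bool.≟ lookup apexVertex j)

      ¬∀-agreeing : ¬ (∀ j → Agreeing j)
      ¬∀-agreeing agree = 1≢0 (≤-antisym 1≤0 (nonNegative⁻¹ 1ℚ))
        where
        apex-minimiser : Minimiser k a⁺ apexVertex
        apex-minimiser = agreeing⇒minimiser {a = a⁺} {apexVertex} (∣vertex∣ k n apex) λ j →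
          let (i , i∈S , ¬apex , agreeᵢ) = agree j in v i , minimiser i∈S ¬apex , agreeᵢ
        1≤0 : 1ℚ ≤ 0ℚ
        1≤0 = let (i₀ , i₀∈S , ¬apex₀ , _) = agree zero in +-cancelˡ-≤ c (begin
          c + 1ℚ                 ≡⟨ cong (λ b → c + b2q b) isApex-apex ⟨
          c + b2q (isApex apex)  ≤⟨ below⁺ apex ⟩
          value a⁺ apexVertex    ≤⟨ proj₂ apex-minimiser (v i₀) (∣vertex∣ k n i₀) ⟩
          value a⁺ (v i₀)        ≡⟨ value≡c i₀∈S ¬apex₀ ⟩
          c                      ≡⟨ +-identityʳ c ⟨
          c + 0ℚ                 ∎)
          where open ≤-Reasoning

      disagreeing⇒⊆C : ∀ {j} → ¬ Agreeing j → S ⊆ C j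
      disagreeing⇒⊆C {j} ¬agreeⱼ {i} i∈S = ∈-tabulate⁺ (memberC j) i (apex-or-differs (isApex i) refl)
        where
        apex-or-differs : ∀ e → isApex i ≡ e → e ∨ differs j (v i) ≡ true
        apex-or-differs true  _     = refl
        apex-or-differs false apexᵢ =
          xor-≢ {lookup (v i) j} {lookup apexVertex j} λ agreeᵢ → ¬agreeⱼ (i , i∈S , apexᵢ , agreeᵢ)

      ⊆C : ∃[ j ] S ⊆ C j
      ⊆C = Product.map id disagreeing⇒⊆C (¬∀⟶∃¬ n Agreeing agreeing? ¬∀-agreeing)

    cell⊆C : ∀ {S} → IsCell k n (κ k n) S → ∃[ j ] S ⊆ C j
    cell⊆C (a₀ ∷ a , c , below , tight) = LowerFace.⊆C a₀ a c below tight

    maxCell≡C : ∀ {S} → IsMaxCell k n (κ k n) S → ∃[ j ] C j ≡ S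
    maxCell≡C (S-cell , S-max) with cell⊆C S-cell
    ... | j , S⊆Cⱼ = j , S-max (C j) (C-isCell j) S⊆Cⱼ

    opposite : Fin n → Bool
    opposite j = not (lookup apexVertex j)

    differs-opposite : ∀ j u → lookup u j ≡ opposite j → differs j u ≡ true
    differs-opposite j u uⱼ = xor-≢ {lookup u j} {lookup apexVertex j} (λ agree → Bool.not-¬ agree uⱼ)

    differs-vertexIndex : ∀ j {u} (∣u∣≡k : ∣ u ∣ ≡ k) → lookup u j ≡ opposite j →
                          differs j (v (vertexIndex u ∣u∣≡k)) ≡ true
    differs-vertexIndex j {u} ∣u∣≡k uⱼ = differs-opposite j (v (vertexIndex u ∣u∣≡k))
      (trans (cong (λ u′ → lookup u′ j) (vertex-vertexIndex u ∣u∣≡k)) uⱼ)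

    differs⇒∈C : ∀ j i → differs j (v i) ≡ true → i ∈ C j
    differs⇒∈C j i dⱼ = ∈-tabulate⁺ (memberC j) i (trans (cong (isApex i ∨_) dⱼ) (Bool.∨-zeroʳ (isApex i)))

    apex∈C : ∀ j → apex ∈ C j
    apex∈C j = ∈-tabulate⁺ (memberC j) apex (cong (_∨ differs j apexVertex) isApex-apex)

    pyramid : ∀ {m} {S : Subset (N k n)} j (Q : Fin m → Vec Bool n) (∣Q∣≡k : ∀ s → ∣ Q s ∣ ≡ k) →
              (∀ s → lookup (Q s) j ≡ opposite j) → AffIndepRows (rows Q) →
              apex ∈ S → (∀ s → vertexIndex (Q s) (∣Q∣≡k s) ∈ S) → IndependentIn k n S (suc m)
    pyramid {m} {S} j Q ∣Q∣≡k Qⱼ indep apex∈S Q∈S = ix , ix∈S , vertexRows⇒affIndep {k} {n} ix (apexVertex ∷ᶠ Q) ix≡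
      (affIndep-∷-private apexVertex Q j (opposite j) Qⱼ (sym (Bool.not-involutive (lookup apexVertex j))) indep)
      where
      ix : Fin (suc m) → Fin (N k n)
      ix = apex ∷ᶠ λ s → vertexIndex (Q s) (∣Q∣≡k s)
      ix≡ : ∀ t → v (ix t) ≡ (apexVertex ∷ᶠ Q) t
      ix≡ zero    = refl
      ix≡ (suc s) = vertex-vertexIndex (Q s) (∣Q∣≡k s)
      ix∈S : ∀ t → ix t ∈ S
      ix∈S zero    = apex∈S
      ix∈S (suc s) = Q∈S s

    C-dim : 1 ℕ.≤ k′ → k ℕ.< n′ → ∀ j → HasDim k n (C j) n′
    C-dim 1≤k′ k<n′ j =
      pyramid j Q ∣Q∣≡k (λ s → Vec.insertAt-lookup (P s) j b) (affIndep-insertAt P j b (proj₂ (proj₂ family)))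
              (apex∈C j) Q∈C ,
      λ ix _ → vert-affDep {k} ix
      where
      b = opposite j
      family : IndependentVertices (k ∸ ∣ b ∷ [] ∣) n′
      family = independentVertices (k ∸ ∣ b ∷ [] ∣) n′
        (ℕ.≤-trans 1≤k′ (ℕ.∸-monoʳ-≤ k (∣p∣≤n (b ∷ []))))
        (ℕ.≤-<-trans (ℕ.m∸n≤m k ∣ b ∷ [] ∣) k<n′)
      P = proj₁ family
      Q : Fin n′ → Vec Bool n
      Q s = Vec.insertAt (P s) j b
      ∣Q∣≡k : ∀ s → ∣ Q s ∣ ≡ k
      ∣Q∣≡k s = trans (∣insertAt∣ (P s) j b)
        (∣++∣≡ (b ∷ []) (P s) (ℕ.≤-trans (∣p∣≤n (b ∷ [])) (s≤s z≤n)) (proj₁ (proj₂ family) s))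
      Q∈C : ∀ s → vertexIndex (Q s) (∣Q∣≡k s) ∈ C j
      Q∈C s = differs⇒∈C j (vertexIndex (Q s) (∣Q∣≡k s))
                         (differs-vertexIndex j (∣Q∣≡k s) (Vec.insertAt-lookup (P s) j b))

  -- The facet shared by two maximal cells

  module Facets (k′ n″ : ℕ) (2≤k′ : 2 ℕ.≤ k′) (k′+2≤n″ : k′ ℕ.+ 2 ℕ.≤ n″) where

    k<n″ : suc k′ ℕ.< n″
    k<n″ = subst (ℕ._≤ n″) (ℕ.+-comm k′ 2) k′+2≤n″

    ∣bb∣≤k : ∀ b b′ → ∣ b ∷ b′ ∷ [] ∣ ℕ.≤ suc k′
    ∣bb∣≤k b b′ = ℕ.≤-trans (∣p∣≤n (b ∷ b′ ∷ [])) (ℕ.≤-trans 2≤k′ (ℕ.n≤1+n k′))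

    k′≤n′ : k′ ℕ.≤ suc n″
    k′≤n′ = ℕ.≤-trans (ℕ.m≤n+m k′ 1) (ℕ.<⇒≤ (ℕ.<-trans k<n″ (ℕ.n<1+n n″)))

    open Subdivision k′ (suc n″) k′≤n′ public

    memberF : Fin n → Fin n → Fin (N k n) → Bool
    memberF j l i = isApex i ∨ (differs j (v i) ∧ differs l (v i))

    F : Fin n → Fin n → Subset (N k n)
    F j l = tabulate (memberF j l)

    F-sym : ∀ j l → F j l ≡ F l j
    F-sym j l = Vec.tabulate-cong λ i → cong (isApex i ∨_) (Bool.∧-comm (differs j (v i)) (differs l (v i)))

    differs⇒∈F : ∀ j l i → differs j (v i) ≡ true → differs l (v i) ≡ true → i ∈ F j l
    differs⇒∈F j l i dⱼ dₗ =
      ∈-tabulate⁺ (memberF j l) i (trans (cong (isApex i ∨_) (cong₂ _∧_ dⱼ dₗ)) (Bool.∨-zeroʳ (isApex i)))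

    F⊆C : ∀ j l → F j l ⊆ C j
    F⊆C j l {i} i∈F = ∈-tabulate⁺ (memberC j) i (weaken (isApex i) _ _ (∈-tabulate⁻ (memberF j l) i i∈F))
      where
      weaken : ∀ e a b → e ∨ (a ∧ b) ≡ true → e ∨ a ≡ true
      weaken true  _    _ _ = refl
      weaken false true _ _ = refl

    faceNormal : Fin n → Fin n → Fin n → ℚ
    faceNormal j l = pairCoeff (σ j) j (- σ l) l

    faceNormal-value : ∀ j l u → sumF (λ i → faceNormal j l i * row u i)
                                 ≡ (τ l - τ j) + (b2q (differs j u) - b2q (differs l u))
    faceNormal-value j l u = begin
      sumF (λ i → faceNormal j l i * row u i)
        ≡⟨ sumF-pairCoeff (σ j) j (- σ l) l (row u) ⟩
      σ j * row u j + - σ l * row u l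
        ≡⟨ solve 6 (λ s x t y a b → s :* x :+ (:- t) :* y := b :- a :+ ((a :+ s :* x) :- (b :+ t :* y)))
                   refl (σ j) (row u j) (σ l) (row u l) (τ j) (τ l) ⟩
      (τ l - τ j) + ((τ j + σ j * row u j) - (τ l + σ l * row u l))
        ≡⟨ cong₂ (λ x y → (τ l - τ j) + (x - y)) (τ+σ*b2q j u) (τ+σ*b2q l u) ⟩
      (τ l - τ j) + (b2q (differs j u) - b2q (differs l u)) ∎
      where open ≡-Reasoning

    differs-difference : ∀ j l i → i ∈ C j → b2q (differs j (v i)) - b2q (differs l (v i)) ≡ b2q (not (memberF j l i))
    differs-difference j l i i∈C = facetIndicator (isApex i) (differs j (v i)) (differs l (v i))
      (∈-tabulate⁻ (memberC j) i i∈C) (λ apex → differs-apex i j apex , differs-apex i l apex)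

    F-face : ∀ j l → IsFaceOf k n (F j l) (C j)
    F-face j l = isFace-tabulate {k} {n} (C j) (tabulate (faceNormal j l)) (τ l - τ j) (memberF j l) (F⊆C j l) height
      where
      height : ∀ i → i ∈ C j →
               dot (tabulate (faceNormal j l)) (vert k n i) ≡ (τ l - τ j) + b2q (not (memberF j l i))
      height i i∈C = trans (dot-tabulate (faceNormal j l) (v i))
        (trans (faceNormal-value j l (v i)) (cong ((τ l - τ j) +_) (differs-difference j l i i∈C)))

    faceForm : Fin n → Fin n → AffineForm n
    faceForm j l = affineForm (τ j - τ l) (faceNormal j l)

    eval-faceForm : ∀ j l u → eval (faceForm j l) (row u) ≡ b2q (differs j u) - b2q (differs l u)
    eval-faceForm j l u = trans (cong ((τ j - τ l) +_) (faceNormal-value j l u))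
      (solve 3 (λ a b x → (a :- b) :+ ((b :- a) :+ x) := x) refl (τ j) (τ l) (b2q (differs j u) - b2q (differs l u)))

    F-independent : ∀ j l (j≢l : j ≢ l) → IndependentIn k n (F j l) (suc n″)
    F-independent j l j≢l =
      pyramid j Q ∣Q∣≡k (λ s → lookup-insertAt₂ˡ j≢l (P s) bⱼ bₗ)
              (affIndep-insertAt₂ j≢l P bⱼ bₗ (proj₂ (proj₂ family))) apex∈F Q∈F
      where
      bⱼ bₗ : Bool
      bⱼ = opposite j
      bₗ = opposite l
      family : IndependentVertices (k ∸ ∣ bⱼ ∷ bₗ ∷ [] ∣) n″
      family = independentVertices (k ∸ ∣ bⱼ ∷ bₗ ∷ [] ∣) n″
        (ℕ.≤-trans (ℕ.∸-monoˡ-≤ 1 2≤k′) (ℕ.∸-monoʳ-≤ k (∣p∣≤n (bⱼ ∷ bₗ ∷ []))))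
        (ℕ.≤-<-trans (ℕ.m∸n≤m k ∣ bⱼ ∷ bₗ ∷ [] ∣) k<n″)
      P = proj₁ family
      Q : Fin n″ → Vec Bool n
      Q s = insertAt₂ j≢l (P s) bⱼ bₗ
      ∣Q∣≡k : ∀ s → ∣ Q s ∣ ≡ k
      ∣Q∣≡k s = trans (∣insertAt₂∣ j≢l (P s) bⱼ bₗ)
                      (∣++∣≡ (bⱼ ∷ bₗ ∷ []) (P s) (∣bb∣≤k bⱼ bₗ) (proj₁ (proj₂ family) s))
      apex∈F : apex ∈ F j l
      apex∈F = ∈-tabulate⁺ (memberF j l) apex (cong (_∨ (differs j apexVertex ∧ differs l apexVertex)) isApex-apex)
      Q∈F : ∀ s → vertexIndex (Q s) (∣Q∣≡k s) ∈ F j l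
      Q∈F s = differs⇒∈F j l (vertexIndex (Q s) (∣Q∣≡k s))
                         (differs-vertexIndex j (∣Q∣≡k s) (lookup-insertAt₂ˡ j≢l (P s) bⱼ bₗ))
                         (differs-vertexIndex l (∣Q∣≡k s) (lookup-insertAt₂ʳ j≢l (P s) bⱼ bₗ))

    -- A vertex q ∈ C j ∖ F j l lies off the hyperplane spanned by F j l, so n affinely independent
    -- vertices of F j l would extend by q to n + 1 affinely independent vertices of Δ(k,n).
    F-dependent : ∀ j l (j≢l : j ≢ l) (ix : Fin n → Fin (N k n)) → (∀ t → ix t ∈ F j l) →
                  ¬ AffIndep (λ t → vert k n (ix t))
    F-dependent j l j≢l ix ix∈F indep = vertices-affDep k (q ∷ᶠ (v ∘ ix)) sizes
      (affIndep-∷-vertex (faceForm j l) q (v ∘ ix) on-F q∉F (affIndep⇒vertexRows {k} {n} ix indep))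
      where
      bⱼ sₗ : Bool
      bⱼ = opposite j
      sₗ = lookup apexVertex l
      witness : Σ (Vec Bool n″) λ w → ∣ w ∣ ≡ k ∸ ∣ bⱼ ∷ sₗ ∷ [] ∣
      witness = someSubset (k ∸ ∣ bⱼ ∷ sₗ ∷ [] ∣) n″
                           (ℕ.≤-trans (ℕ.m∸n≤m k ∣ bⱼ ∷ sₗ ∷ [] ∣) (ℕ.<⇒≤ k<n″))
      q : Vec Bool n
      q = insertAt₂ j≢l (proj₁ witness) bⱼ sₗ
      sizes : ∀ t → ∣ (q ∷ᶠ (v ∘ ix)) t ∣ ≡ k
      sizes zero    = trans (∣insertAt₂∣ j≢l (proj₁ witness) bⱼ sₗ)
                            (∣++∣≡ (bⱼ ∷ sₗ ∷ []) (proj₁ witness) (∣bb∣≤k bⱼ sₗ) (proj₂ witness))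
      sizes (suc t) = ∣vertex∣ k n (ix t)
      on-F : ∀ t → eval (faceForm j l) (row (v (ix t))) ≡ 0ℚ
      on-F t = trans (eval-faceForm j l (v (ix t)))
        (trans (differs-difference j l (ix t) (F⊆C j l (ix∈F t)))
               (cong (b2q ∘ not) (∈-tabulate⁻ (memberF j l) (ix t) (ix∈F t))))
      q∉F : eval (faceForm j l) (row q) ≢ 0ℚ
      q∉F eq = 1≢0 (trans (cong₂ (λ x y → b2q x - b2q y) (sym qⱼ) (sym qₗ)) (trans (sym (eval-faceForm j l q)) eq))
        where
        qⱼ : differs j q ≡ true
        qⱼ = differs-opposite j q (lookup-insertAt₂ˡ j≢l (proj₁ witness) bⱼ sₗ)
        qₗ : differs l q ≡ false
        qₗ = trans (cong (_xor sₗ) (lookup-insertAt₂ʳ j≢l (proj₁ witness) bⱼ sₗ)) (Bool.xor-same sₗ)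

    F-dim : ∀ j l → j ≢ l → HasDim k n (F j l) n″
    F-dim j l j≢l = F-independent j l j≢l , λ ix ix∈F → F-dependent j l j≢l ix ix∈F

    C-adjacent : ∀ j l → j ≢ l → Adjacent k n (C j) (C l)
    C-adjacent j l j≢l =
      F j l , n″ , F-face j l , subst (λ F′ → IsFaceOf k n F′ (C l)) (F-sym l j) (F-face l j) ,
      C-dim 1≤k′ k<n′ j , C-dim 1≤k′ k<n′ l , F-dim j l j≢l
      where
      1≤k′ : 1 ℕ.≤ k′
      1≤k′ = ℕ.≤-trans (s≤s z≤n) 2≤k′
      k<n′ : k ℕ.< suc n″
      k<n′ = ℕ.<-trans k<n″ (ℕ.n<1+n n″)

    maxCells-adjacent : ∀ {P Q} → IsMaxCell k n (κ k n) P → IsMaxCell k n (κ k n) Q → P ≢ Q → Adjacent k n P Q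
    maxCells-adjacent P-max Q-max P≢Q =
      let (j , Cⱼ≡P) = maxCell≡C P-max
          (l , Cₗ≡Q) = maxCell≡C Q-max
      in subst₂ (Adjacent k n) Cⱼ≡P Cₗ≡Q
                (C-adjacent j l λ j≡l → P≢Q (trans (sym Cⱼ≡P) (trans (cong C j≡l) Cₗ≡Q)))


open Hypersimplex using (module Facets)
open import Data.Nat using (ℕ; zero; suc; s≤s; _<_; _+_)

lemma4p10 : (k n : ℕ) → 2 < k → k + 2 < n → DualGraphComplete k n (κ k n)
lemma4p10 zero          n             ()        _
lemma4p10 (suc k)       zero          _         ()
lemma4p10 (suc k)       (suc zero)    _         (s≤s ())
lemma4p10 (suc k)       (suc (suc n)) (s≤s 2≤k) (s≤s (s≤s k+2≤n)) P Q = maxCells-adjacent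
  where open Facets k n 2≤k k+2≤n
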